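{- Let $n$ be a prime. Every nonzero integer $x$ such that $n$ divides $x$ exactly once (i.e. $n\mid x$ but $n^2\nmid x$) is a $\tau_n$-atom. Every nonzero integer $y$ such that $n^2\mid y$ is not a $\tau_n$-atom.
   Context: For a positive integer $n$ and integers $x,y$, write $x\,\tau_n\,y$ if $x\equiv y \pmod n$. For a nonzero nonunit integer $x$, a $\tau_n$-factorization of $x$ is an expression $x=\lambda a_1a_2\cdots a_k$ with $\lambda\in\{1,-1\}$, each $a_i$ a nonzero nonunit integer (i.e. $a_i\neq 0,\pm1$), and $a_i\equiv a_j \pmod n$ for all $i,j$; it is proper if $k>1$. A nonzero nonunit integer $x$ is a $\tau_n$-atom if it has no proper $\tau_n$-factorization. -}

module Defs where

open import Data.Nat using (ℕ; suc; _≤_; _^_)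
open import Data.Integer using (ℤ; +_; -_; _-_; _*_; ∣_∣; 1ℤ; -1ℤ)
open import Data.Integer.Divisibility using (_∣_)
open import Data.List using (List; length; foldr)
open import Data.List.Relation.Unary.All using (All)
open import Data.Product using (Σ; _×_)
open import Data.Sum using (_⊎_)
open import Relation.Binary.PropositionalEquality using (_≡_)
open import Relation.Nullary using (¬_)

_τ[_]_ : ℤ → ℕ → ℤ → Set
x τ[ n ] y = (+ n) ∣ (x - y)

NonzeroNonunit : ℤ → Set
NonzeroNonunit a = 2 ≤ ∣ a ∣

productℤ : List ℤ → ℤ
productℤ = foldr _*_ 1ℤ

IsSign : ℤ → Set
IsSign s = (s ≡ 1ℤ) ⊎ (s ≡ -1ℤ)

record τFactorization (n : ℕ) (x : ℤ) : Set where
  field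
    sign     : ℤ
    factors  : List ℤ
    signOk   : IsSign sign
    nonunits : All NonzeroNonunit factors
    congr    : All (λ a → All (λ b → a τ[ n ] b) factors) factors
    eq       : x ≡ sign * productℤ factors

IsProper : {n : ℕ} {x : ℤ} → τFactorization n x → Set
IsProper f = 2 ≤ length (τFactorization.factors f)

IsτAtom : ℕ → ℤ → Set
IsτAtom n x = NonzeroNonunit x × ((f : τFactorization n x) → ¬ IsProper f)

module Submission where

-- Let x = λ a₁ ⋯ a_k be a proper τ_n-factorization (k ≥ 2) of a
-- multiple x of the prime n.  By Euclid's lemma n divides some aᵢ; since all
-- factors are congruent mod n, n then divides every factor
-- ('factors-of-multiple-are-multiples').  Hence n² ∣ a₁a₂ ∣ x
-- ('proper-factorization⇒square∣'), contradicting n² ∤ x.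
--
-- If y = q·n² ≠ 0 then y = n · (qn) is a proper τ_n-factorization:
-- both factors are nonzero multiples of n, hence nonunits, and any two
-- multiples of n are congruent mod n ('square∣⇒proper-factorization').
--
-- Divisibility of integers in the statement is unsigned (n ∣ x means n ∣ |x|
-- in ℕ), so most arithmetic is done on absolute values.

open import Defs
open import Data.Nat using (ℕ; _^_; _≤_; s≤s; z≤n; nonTrivial⇒n>1; ≢-nonZero) renaming (_*_ to _*ℕ_)
open import Data.Nat.Properties using (≤-trans; <⇒≢)
import Data.Nat.Properties as ℕ
open import Data.Nat.Divisibility using (∣⇒≤; ∣1⇒≡1; ∣m⇒∣m*n; n∣m*n; *-pres-∣; ∣-refl; module ∣-Reasoning)
  renaming (_∣_ to _∣ℕ_)
open import Data.Nat.Primality using (Prime; euclidsLemma; prime⇒nonTrivial)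
open import Data.Integer using (ℤ; +_; _-_; 0ℤ; 1ℤ; -1ℤ; _*_; ∣_∣)
open import Data.Integer.Properties using (abs-*; ∣i∣≡0⇒i≡0; pos-*; *-identityˡ; *-identityʳ; *-zeroʳ; *-assoc; *-comm)
open import Data.Integer.Divisibility using (_∣_)
import Data.Integer.Divisibility.Signed as Signed
open import Data.List using (List; []; _∷_)
open import Data.List.Relation.Unary.All as All using (All; []; _∷_)
open import Data.List.Relation.Unary.Any using (Any; here; there)
open import Data.Product using (Σ; _×_; _,_; proj₁; proj₂)
open import Data.Sum using (inj₁; inj₂)
open import Data.Empty using (⊥-elim)
open import Function using (_∘_)
open import Relation.Binary.PropositionalEquality using (_≡_; _≢_; refl; sym; trans; cong; subst; module ≡-Reasoning)
open import Relation.Nullary using (¬_)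

prime⇒2≤ : ∀ {n} → Prime n → 2 ≤ n
prime⇒2≤ {n} p = nonTrivial⇒n>1 n {{prime⇒nonTrivial p}}

n^2≡n*n : ∀ n → n ^ 2 ≡ n *ℕ n
n^2≡n*n n = cong (n *ℕ_) (ℕ.*-identityʳ n)

+[n^2]≡+n*+n : ∀ n → + (n ^ 2) ≡ + n * + n
+[n^2]≡+n*+n n = trans (cong +_ (n^2≡n*n n)) (pos-* n n)

nonzero-multiple⇒nonunit : ∀ {m x} → 2 ≤ m → x ≢ 0ℤ → + m ∣ x → NonzeroNonunit x
nonzero-multiple⇒nonunit 2≤m x≢0 m∣x =
  ≤-trans 2≤m (∣⇒≤ {{≢-nonZero (x≢0 ∘ ∣i∣≡0⇒i≡0)}} m∣x)

multiples-congruent : ∀ {n a c} → + n ∣ a → + n ∣ c → a τ[ n ] c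
multiples-congruent {n} {a} {c} n∣a n∣c = Signed.∣⇒∣ᵤ {+ n} {a - c}
  (Signed.∣m∣n⇒∣m-n (Signed.∣ᵤ⇒∣ {+ n} {a} n∣a) (Signed.∣ᵤ⇒∣ {+ n} {c} n∣c))

-- Anything congruent mod n to a multiple of n is a multiple of n
-- (a = (a - c) + c, and a - c is by definition a + (- c)).
congruent-to-multiple : ∀ {n a c} → a τ[ n ] c → + n ∣ c → + n ∣ a
congruent-to-multiple {n} {a} {c} a≡c n∣c = Signed.∣⇒∣ᵤ {+ n} {a}
  (Signed.∣m+n∣n⇒∣m (Signed.∣ᵤ⇒∣ {+ n} {a - c} a≡c) (Signed.∣m⇒∣-m (Signed.∣ᵤ⇒∣ {+ n} {c} n∣c)))

∣sign*z∣≡∣z∣ : ∀ {s} z → IsSign s → ∣ s * z ∣ ≡ ∣ z ∣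
∣sign*z∣≡∣z∣ z (inj₁ refl) = cong ∣_∣ (*-identityˡ z)
∣sign*z∣≡∣z∣ z (inj₂ refl) = trans (abs-* -1ℤ z) (ℕ.*-identityˡ ∣ z ∣)

∣x∣≡∣product∣ : ∀ {n x} (f : τFactorization n x) → ∣ x ∣ ≡ ∣ productℤ (τFactorization.factors f) ∣
∣x∣≡∣product∣ f = trans (cong ∣_∣ eq) (∣sign*z∣≡∣z∣ (productℤ factors) signOk)
  where open τFactorization f

prime∣product⇒∣factor : ∀ {p} → Prime p → (l : List ℤ) → p ∣ℕ ∣ productℤ l ∣ → Any (+ p ∣_) l
prime∣product⇒∣factor pr [] p∣1 = ⊥-elim (<⇒≢ (prime⇒2≤ pr) (sym (∣1⇒≡1 p∣1)))
prime∣product⇒∣factor {p} pr (c ∷ l) p∣cl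
  with euclidsLemma ∣ c ∣ ∣ productℤ l ∣ pr (subst (p ∣ℕ_) (abs-* c (productℤ l)) p∣cl)
... | inj₁ p∣c = here p∣c
... | inj₂ p∣l = there (prime∣product⇒∣factor pr l p∣l)

congruent-to-list-with-multiple : ∀ {n a} {l : List ℤ} →
  All (a τ[ n ]_) l → Any (+ n ∣_) l → + n ∣ a
congruent-to-list-with-multiple {n} {a} =
  All.lookupWith (λ {c} a≡c n∣c → congruent-to-multiple {n} {a} {c} a≡c n∣c)

-- Every factor of a τ_n-factorization of a multiple of the prime n is itself a
-- multiple of n: n divides one factor, and all factors are congruent to it.
factors-of-multiple-are-multiples : ∀ {n x} → Prime n → + n ∣ x →
  (f : τFactorization n x) → All (+ n ∣_) (τFactorization.factors f)
factors-of-multiple-are-multiples {n} pr n∣x f =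
  All.map (λ {a} a≡factors → congruent-to-list-with-multiple {n} {a} a≡factors n∣some) congr
  where
  open τFactorization f
  n∣some : Any (+ n ∣_) factors
  n∣some = prime∣product⇒∣factor pr factors (subst (n ∣ℕ_) (∣x∣≡∣product∣ f) n∣x)

square∣product : ∀ {n a b} (r : List ℤ) → + n ∣ a → + n ∣ b → + (n ^ 2) ∣ productℤ (a ∷ b ∷ r)
square∣product {n} {a} {b} r n∣a n∣b = begin
  n ^ 2                            ≡⟨ n^2≡n*n n ⟩
  n *ℕ n                           ∣⟨ *-pres-∣ n∣a (∣m⇒∣m*n ∣ productℤ r ∣ n∣b) ⟩
  ∣ a ∣ *ℕ (∣ b ∣ *ℕ ∣ productℤ r ∣) ≡⟨ cong (∣ a ∣ *ℕ_) (abs-* b (productℤ r)) ⟨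
  ∣ a ∣ *ℕ ∣ b * productℤ r ∣        ≡⟨ abs-* a (b * productℤ r) ⟨
  ∣ a * (b * productℤ r) ∣           ∎
  where open ∣-Reasoning

proper-factorization⇒square∣ : ∀ {n x} → Prime n → + n ∣ x →
  (f : τFactorization n x) → IsProper f → + (n ^ 2) ∣ x
proper-factorization⇒square∣ {n} {x} pr n∣x f proper
  with τFactorization.factors f | ∣x∣≡∣product∣ f | factors-of-multiple-are-multiples pr n∣x f | proper
... | a ∷ b ∷ r | ∣x∣≡∣abr∣ | n∣a ∷ n∣b ∷ _ | s≤s (s≤s z≤n) =
  subst ((n ^ 2) ∣ℕ_) (sym ∣x∣≡∣abr∣) (square∣product {n} {a} {b} r n∣a n∣b)

multiples-pairwise-congruent : ∀ {n} {l : List ℤ} → All (+ n ∣_) l → All (λ a → All (a τ[ n ]_) l) l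
multiples-pairwise-congruent {n} n∣l =
  All.map (λ {a} n∣a → All.map (λ {c} n∣c → multiples-congruent {n} {a} {c} n∣a n∣c) n∣l) n∣l

factorization-into-multiples : ∀ {n x} (l : List ℤ) → All NonzeroNonunit l → All (+ n ∣_) l →
  x ≡ productℤ l → τFactorization n x
factorization-into-multiples l nonunits n∣l x≡l = record
  { sign     = 1ℤ
  ; factors  = l
  ; signOk   = inj₁ refl
  ; nonunits = nonunits
  ; congr    = multiples-pairwise-congruent n∣l
  ; eq       = trans x≡l (sym (*-identityˡ (productℤ l)))
  }

square∣⇒split : ∀ {n y} → + (n ^ 2) ∣ y → Σ ℤ (λ q → y ≡ productℤ (+ n ∷ q * + n ∷ []))
square∣⇒split {n} {y} n²∣y = q , (begin
  y                     ≡⟨ Signed._∣_.equality n²∣ʸy ⟩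
  q * + (n ^ 2)         ≡⟨ cong (q *_) (+[n^2]≡+n*+n n) ⟩
  q * (+ n * + n)       ≡⟨ *-assoc q (+ n) (+ n) ⟨
  q * + n * + n         ≡⟨ *-comm (q * + n) (+ n) ⟩
  + n * (q * + n)       ≡⟨ cong (+ n *_) (*-identityʳ (q * + n)) ⟨
  + n * (q * + n * 1ℤ)  ∎)
  where
  open ≡-Reasoning
  n²∣ʸy = Signed.∣ᵤ⇒∣ {+ (n ^ 2)} {y} n²∣y
  q : ℤ
  q = Signed._∣_.quotient n²∣ʸy

square∣⇒proper-factorization : ∀ {n y} → Prime n → y ≢ 0ℤ → + (n ^ 2) ∣ y →
  Σ (τFactorization n y) IsProper
square∣⇒proper-factorization {n} {y} pr y≢0 n²∣y =
  factorization-into-multiples (+ n ∷ qn ∷ []) nonunits multiples y≡n*qn , s≤s (s≤s z≤n)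
  where
  split = square∣⇒split {n} {y} n²∣y
  qn : ℤ
  qn = proj₁ split * + n
  y≡n*qn : y ≡ productℤ (+ n ∷ qn ∷ [])
  y≡n*qn = proj₂ split
  qn≢0 : qn ≢ 0ℤ
  qn≢0 qn≡0 = y≢0 (trans y≡n*qn (trans (cong (λ z → productℤ (+ n ∷ z ∷ [])) qn≡0) (*-zeroʳ (+ n))))
  n∣qn : + n ∣ qn
  n∣qn = subst (n ∣ℕ_) (sym (abs-* (proj₁ split) (+ n))) (n∣m*n ∣ proj₁ split ∣)
  multiples : All (+ n ∣_) (+ n ∷ qn ∷ [])
  multiples = ∣-refl {n} ∷ n∣qn ∷ []
  nonunits : All NonzeroNonunit (+ n ∷ qn ∷ [])
  nonunits = prime⇒2≤ pr ∷ nonzero-multiple⇒nonunit (prime⇒2≤ pr) qn≢0 n∣qn ∷ []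

theorem4 : (n : ℕ) → Prime n →
    ((x : ℤ) → x ≢ 0ℤ → (+ n) ∣ x → ¬ ((+ (n ^ 2)) ∣ x) → IsτAtom n x)
    × ((y : ℤ) → y ≢ 0ℤ → (+ (n ^ 2)) ∣ y → ¬ IsτAtom n y)
theorem4 n pr = atom , nonAtom
  where
  atom : (x : ℤ) → x ≢ 0ℤ → (+ n) ∣ x → ¬ ((+ (n ^ 2)) ∣ x) → IsτAtom n x
  atom x x≢0 n∣x n²∤x =
    nonzero-multiple⇒nonunit (prime⇒2≤ pr) x≢0 n∣x ,
    λ f proper → n²∤x (proper-factorization⇒square∣ pr n∣x f proper)

  nonAtom : (y : ℤ) → y ≢ 0ℤ → (+ (n ^ 2)) ∣ y → ¬ IsτAtom n y
  nonAtom y y≢0 n²∣y (_ , noProperFactorization) =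
    let (f , proper) = square∣⇒proper-factorization pr y≢0 n²∣y in noProperFactorization f proper
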